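{- Let $\overline{(\cdot)}$ be the translation of $\lambda\mathbf{J}$ into the $\lambda$-calculus given by $\overline{t}=\lambda gk.(t:g,k)$, $(x:G,K)=xGK$, $(\lambda x.t:G,K)=[K(\lambda wx.w\,\overline{t});G]$, $(t(u,x.v):G,K)=(t:G^+,\lambda m.m\,(\lambda x.(v:G,K))\,\overline{u})$. If $t\rightarrow u$ in $\lambda\mathbf{J}$, then $\overline{t}\rightarrow^+_\beta\overline{u}$ in the $\lambda$-calculus.
   Context: $\lambda\mathbf{J}$: terms $t,u,v::=x\mid\lambda x.t\mid t(u,x.v)$ ($x$ bound in $v$; capture-avoiding substitution). A value $V$ is a variable or a $\lambda$-abstraction. Generalised arguments $R,S$ are pairs $(u,x.v)$, $tRS$ means $(tR)S$; $(u,x.V)@S=(u,x.VS)$, $(u,x.tR')@S=(u,x.t(R'@S))$. Reduction: closure under all constructors of $(\lambda x.t)(u,y.v)\rightarrow[[u/x]t/y]v$ and $tRS\rightarrow t(R@S)$. In the translation, $g,k,w,m$ are fresh variables, $[t;u]:=(\lambda y.t)u$ with $y$ not free in $t$, and $G^+:=\mathsf{s}\,G$ for a fixed closed $\lambda$-term $\mathsf{s}$ such that $\mathsf{s}\,G\rightarrow^+_\beta G$ for all $G$ (e.g. $\mathsf{s}=\lambda z.z$). -}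

module Defs where

-- Variable names are represented by indices, so
-- capture-avoiding substitution and alpha-equivalence are built in.

open import Data.Nat using (ℕ; zero; suc)
open import Data.Fin using (Fin; zero; suc)
open import Function using (_∘_; id)
open import Relation.Binary.Construct.Closure.Transitive using (TransClosure)

data Λ (n : ℕ) : Set where
  var : Fin n → Λ n
  lam : Λ (suc n) → Λ n
  app : Λ n → Λ n → Λ n

ext : ∀ {n m} → (Fin n → Fin m) → Fin (suc n) → Fin (suc m)
ext ρ zero    = zero
ext ρ (suc i) = suc (ρ i)

rename : ∀ {n m} → (Fin n → Fin m) → Λ n → Λ m
rename ρ (var x)   = var (ρ x)
rename ρ (lam t)   = lam (rename (ext ρ) t)
rename ρ (app t u) = app (rename ρ t) (rename ρ u)

exts : ∀ {n m} → (Fin n → Λ m) → Fin (suc n) → Λ (suc m)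
exts σ zero    = var zero
exts σ (suc i) = rename suc (σ i)

subst : ∀ {n m} → (Fin n → Λ m) → Λ n → Λ m
subst σ (var x)   = σ x
subst σ (lam t)   = lam (subst (exts σ) t)
subst σ (app t u) = app (subst σ t) (subst σ u)

_[_] : ∀ {n} → Λ (suc n) → Λ n → Λ n
t [ u ] = subst σ t
  where
  σ : _ → _
  σ zero    = u
  σ (suc i) = var i

infix 4 _→β_
data _→β_ {n : ℕ} : Λ n → Λ n → Set where
  β    : ∀ {t u} → app (lam t) u →β t [ u ]
  ξlam : ∀ {t t'} → t →β t' → lam t →β lam t'
  ξappˡ : ∀ {t t' u} → t →β t' → app t u →β app t' u
  ξappʳ : ∀ {t u u'} → u →β u' → app t u →β app t u'

infix 4 _→β⁺_
_→β⁺_ : ∀ {n} → Λ n → Λ n → Set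
_→β⁺_ = TransClosure _→β_

embed : ∀ {n} → Λ 0 → Λ n
embed = rename (λ ())

-- λJ : t ::= x | λx.t | t(u, x.v)   (x bound in v, i.e. index 0 of v)

data J (n : ℕ) : Set where
  jvar : Fin n → J n
  jlam : J (suc n) → J n
  japp : J n → J n → J (suc n) → J n

jrename : ∀ {n m} → (Fin n → Fin m) → J n → J m
jrename ρ (jvar x)     = jvar (ρ x)
jrename ρ (jlam t)     = jlam (jrename (ext ρ) t)
jrename ρ (japp t u v) = japp (jrename ρ t) (jrename ρ u) (jrename (ext ρ) v)

jexts : ∀ {n m} → (Fin n → J m) → Fin (suc n) → J (suc m)
jexts σ zero    = jvar zero
jexts σ (suc i) = jrename suc (σ i)

jsubst : ∀ {n m} → (Fin n → J m) → J n → J m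
jsubst σ (jvar x)     = σ x
jsubst σ (jlam t)     = jlam (jsubst (jexts σ) t)
jsubst σ (japp t u v) = japp (jsubst σ t) (jsubst σ u) (jsubst (jexts σ) v)

_⟦_⟧ : ∀ {n} → J (suc n) → J n → J n
t ⟦ u ⟧ = jsubst σ t
  where
  σ : _ → _
  σ zero    = u
  σ (suc i) = jvar i

-- Appending a generalised argument S = (u', x.v') to the body of a
-- generalised argument:  appBody V S = V S  (V a value) and
-- appBody (t R') S = t (R' @ S).  Then (u, x.v) @ S = (u, x. appBody v S↑),
-- where S↑ is S weakened under the binder x.
appBody : ∀ {n} → J n → J n → J (suc n) → J n
appBody (jvar x)     u' v' = japp (jvar x) u' v'
appBody (jlam t)     u' v' = japp (jlam t) u' v'
appBody (japp t u v) u' v' =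
  japp t u (appBody v (jrename suc u') (jrename (ext suc) v'))

infix 4 _→J_
data _→J_ {n : ℕ} : J n → J n → Set where
  βJ  : ∀ {t u v} → japp (jlam t) u v →J v ⟦ t ⟦ u ⟧ ⟧
  -- t R S → t (R @ S)     with R = (u, x.v), S = (u', y.v')
  πJ  : ∀ {t u v u' v'} →
        japp (japp t u v) u' v' →J
        japp t u (appBody v (jrename suc u') (jrename (ext suc) v'))
  ξlam : ∀ {t t'} → t →J t' → jlam t →J jlam t'
  ξ₁  : ∀ {t t' u v} → t →J t' → japp t u v →J japp t' u v
  ξ₂  : ∀ {t u u' v} → u →J u' → japp t u v →J japp t u' v
  ξ₃  : ∀ {t u v v'} → v →J v' → japp t u v →J japp t u v'

-- The translation, parameterised by the closed term s (G⁺ = s G).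
-- colon s t ρ G K  is  (t : G, K), where t ∈ J n is read in the
-- λ-context m via the variable renaming ρ (needed for structural
-- recursion; the translation proper uses ρ = id).
-- barR s t ρ is the translation  t̄ = λ g k. (t : g, k)  read via ρ.

wk : ∀ {m} → Fin m → Fin (suc m)
wk = suc

wk2 : ∀ {m} → Fin m → Fin (suc (suc m))
wk2 i = suc (suc i)

mutual
  colon : ∀ {n m} → Λ 0 → J n → (Fin n → Fin m) → Λ m → Λ m → Λ m
  colon s (jvar x) ρ G K = app (app (var (ρ x)) G) K
  -- (λx.t : G, K) = [K (λ w x. w t̄) ; G] = (λy. K (λ w x. w t̄)) G
  colon s (jlam t) ρ G K =
    app (lam (rename suc
           (app K (lam (lam (app (var (suc zero))
                                 (barR s t (ext (wk ∘ ρ))))))))) G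
  colon s (japp t u v) ρ G K =
    colon s t ρ (app (embed s) G)
      (lam (app (app (var zero)
                     (lam (colon s v (ext (wk ∘ ρ))
                                     (rename wk2 G)
                                     (rename wk2 K))))
                (barR s u (wk ∘ ρ))))

  barR : ∀ {n m} → Λ 0 → J n → (Fin n → Fin m) → Λ m
  barR s t ρ = lam (lam (colon s t (wk2 ∘ ρ) (var (suc zero)) (var zero)))

translate : ∀ {n} → Λ 0 → J n → Λ n
translate s t = barR s t id

module Submission where

-- The colon translation (t : G, K) is stable under renaming, strictly monotone in G and K, and
-- satisfies a substitution lemma: substituting ū for x reduces (t : G, K) to ([u/x]t : G, K).
-- A β-redex (λx.t)(u, y.v) is then simulated by five β-steps and two instances of the
-- substitution lemma. The translation of a π-redex t R S is that of t (R @ S) with s G⁺ instead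
-- of G⁺ at the head t and (v : G⁺, K_S) instead of (v S : G, K) inside R = (u, x.v); the
-- hypothesis s G →⁺ G removes the former strictly, and induction on v handles the latter.

open import Defs
open import Data.Nat using (ℕ; suc)
open import Data.Fin using (Fin; zero; suc)
open import Function using (_∘_; id)
open import Relation.Binary.PropositionalEquality using (_≡_; refl; sym; trans; cong; cong₂)
open import Relation.Binary.Construct.Closure.Transitive using (_∷_) renaming ([_] to [_]⁺)
open import Relation.Binary.Construct.Closure.ReflexiveTransitive using (Star; ε; _◅_; _◅◅_; gmap)
import Relation.Binary.Construct.Closure.ReflexiveTransitive.Properties as Star

private
  variable
    n m k : ℕ

rename-rename : ∀ {f : Fin n → Fin m} {g : Fin m → Fin k} {h : Fin n → Fin k} →
  (∀ x → g (f x) ≡ h x) → ∀ t → rename g (rename f t) ≡ rename h t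
rename-rename e (var x)   = cong var (e x)
rename-rename e (app t u) = cong₂ app (rename-rename e t) (rename-rename e u)
rename-rename e (lam t)   = cong lam (rename-rename e′ t)
  where
  e′ : ∀ x → _
  e′ zero    = refl
  e′ (suc x) = cong suc (e x)

subst-rename : ∀ {f : Fin n → Fin m} {σ : Fin m → Λ k} {τ : Fin n → Λ k} →
  (∀ x → σ (f x) ≡ τ x) → ∀ t → subst σ (rename f t) ≡ subst τ t
subst-rename e (var x)   = e x
subst-rename e (app t u) = cong₂ app (subst-rename e t) (subst-rename e u)
subst-rename e (lam t)   = cong lam (subst-rename e′ t)
  where
  e′ : ∀ x → _
  e′ zero    = refl
  e′ (suc x) = cong (rename suc) (e x)

rename-subst : ∀ {f : Fin m → Fin k} {σ : Fin n → Λ m} {τ : Fin n → Λ k} →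
  (∀ x → rename f (σ x) ≡ τ x) → ∀ t → rename f (subst σ t) ≡ subst τ t
rename-subst e (var x)   = e x
rename-subst e (app t u) = cong₂ app (rename-subst e t) (rename-subst e u)
rename-subst {σ = σ} e (lam t) = cong lam (rename-subst e′ t)
  where
  e′ : ∀ x → _
  e′ zero    = refl
  e′ (suc x) = trans (rename-rename (λ _ → refl) (σ x))
                     (trans (sym (rename-rename (λ _ → refl) (σ x))) (cong (rename suc) (e x)))

subst-var : ∀ {f : Fin n → Fin m} {σ : Fin n → Λ m} →
  (∀ x → σ x ≡ var (f x)) → ∀ t → subst σ t ≡ rename f t
subst-var e (var x)   = e x
subst-var e (app t u) = cong₂ app (subst-var e t) (subst-var e u)
subst-var e (lam t)   = cong lam (subst-var e′ t)
  where
  e′ : ∀ x → _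
  e′ zero    = refl
  e′ (suc x) = cong (rename suc) (e x)

rename-id : ∀ {f : Fin n → Fin n} → (∀ x → f x ≡ x) → ∀ t → rename f t ≡ t
rename-id e (var x)   = cong var (e x)
rename-id e (app t u) = cong₂ app (rename-id e t) (rename-id e u)
rename-id e (lam t)   = cong lam (rename-id e′ t)
  where
  e′ : ∀ x → _
  e′ zero    = refl
  e′ (suc x) = cong suc (e x)

subst-id : ∀ {σ : Fin n → Λ n} → (∀ x → σ x ≡ var x) → ∀ t → subst σ t ≡ t
subst-id e t = trans (subst-var e t) (rename-id (λ _ → refl) t)

weaken-[] : (t : Λ n) (u : Λ n) → rename suc t [ u ] ≡ t
weaken-[] t u = trans (subst-rename (λ _ → refl) t) (subst-id (λ _ → refl) t)

rename-[] : (f : Fin n → Fin m) (t : Λ (suc n)) (u : Λ n) →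
  rename f (t [ u ]) ≡ rename (ext f) t [ rename f u ]
rename-[] {n} {m} f t u = trans (rename-subst {τ = τ} (λ { zero → refl ; (suc x) → refl }) t)
                              (sym (subst-rename (λ { zero → refl ; (suc x) → refl }) t))
  where
  τ : Fin (suc n) → Λ m
  τ zero    = rename f u
  τ (suc x) = var (f x)

subst-exts-weaken : (σ : Fin n → Λ m) (t : Λ n) →
  subst (exts σ) (rename suc t) ≡ rename suc (subst σ t)
subst-exts-weaken σ t = trans (subst-rename (λ _ → refl) t) (sym (rename-subst (λ _ → refl) t))

subst-exts²-weaken² : (σ : Fin n → Λ m) (t : Λ n) →
  subst (exts (exts σ)) (rename wk2 t) ≡ rename wk2 (subst σ t)
subst-exts²-weaken² σ t =
  trans (subst-rename (λ _ → refl) t)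
        (sym (rename-subst (λ x → sym (rename-rename (λ _ → refl) (σ x))) t))

subst-exts-wk2 : ∀ {σ : Fin (suc n) → Λ n} → (∀ x → σ (suc x) ≡ var x) →
  ∀ t → subst (exts σ) (rename wk2 t) ≡ rename suc t
subst-exts-wk2 e t = trans (subst-rename (λ _ → refl) t) (subst-var (λ x → cong (rename suc) (e x)) t)

rename-embed : (f : Fin n → Fin m) (s : Λ 0) → rename f (embed s) ≡ embed s
rename-embed f = rename-rename (λ ())

subst-embed : (σ : Fin n → Λ m) (s : Λ 0) → subst σ (embed s) ≡ embed s
subst-embed σ s = trans (subst-rename {τ = λ ()} (λ ()) s) (subst-var {f = λ ()} (λ ()) s)

infix 4 _→β*_
_→β*_ : Λ n → Λ n → Set
_→β*_ = Star _→β_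

⁺⇒* : ∀ {t u : Λ n} → t →β⁺ u → t →β* u
⁺⇒* [ r ]⁺   = r ◅ ε
⁺⇒* (r ∷ p) = r ◅ ⁺⇒* p

infixr 5 _◅⁺_ _⁺◅◅*_

_◅⁺_ : ∀ {t u v : Λ n} → t →β u → u →β* v → t →β⁺ v
r ◅⁺ ε       = [ r ]⁺
r ◅⁺ (q ◅ p) = r ∷ (q ◅⁺ p)

_⁺◅◅*_ : ∀ {t u v : Λ n} → t →β⁺ u → u →β* v → t →β⁺ v
[ r ]⁺  ⁺◅◅* q = r ◅⁺ q
(r ∷ p) ⁺◅◅* q = r ∷ (p ⁺◅◅* q)

β-≡ : ∀ {t : Λ (suc n)} {u r} → t [ u ] ≡ r → app (lam t) u →β r
β-≡ refl = β

module _ (F : Λ n → Λ m) (F-→β : ∀ {t u} → t →β u → F t →β F u) where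

  map⁺ : ∀ {t u} → t →β⁺ u → F t →β⁺ F u
  map⁺ [ r ]⁺   = [ F-→β r ]⁺
  map⁺ (r ∷ p) = F-→β r ∷ map⁺ p

  map* : ∀ {t u} → t →β* u → F t →β* F u
  map* = gmap F F-→β

lam* : ∀ {t u : Λ (suc n)} → t →β* u → lam t →β* lam u
lam* = map* lam ξlam

lam⁺ : ∀ {t u : Λ (suc n)} → t →β⁺ u → lam t →β⁺ lam u
lam⁺ = map⁺ lam ξlam

appˡ* : ∀ {t u v : Λ n} → t →β* u → app t v →β* app u v
appˡ* {v = v} = map* (λ t → app t v) ξappˡ

appˡ⁺ : ∀ {t u v : Λ n} → t →β⁺ u → app t v →β⁺ app u v
appˡ⁺ {v = v} = map⁺ (λ t → app t v) ξappˡ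

appʳ* : ∀ {t u v : Λ n} → t →β* u → app v t →β* app v u
appʳ* {v = v} = map* (app v) ξappʳ

appʳ⁺ : ∀ {t u v : Λ n} → t →β⁺ u → app v t →β⁺ app v u
appʳ⁺ {v = v} = map⁺ (app v) ξappʳ

app* : ∀ {t t′ u u′ : Λ n} → t →β* t′ → u →β* u′ → app t u →β* app t′ u′
app* p q = appˡ* p ◅◅ appʳ* q

rename-→β : (f : Fin n → Fin m) {t u : Λ n} → t →β u → rename f t →β rename f u
rename-→β f (β {t} {u}) = β-≡ (sym (rename-[] f t u))
rename-→β f (ξlam r)    = ξlam (rename-→β (ext f) r)
rename-→β f (ξappˡ r)   = ξappˡ (rename-→β f r)
rename-→β f (ξappʳ r)   = ξappʳ (rename-→β f r)

rename-→β* : (f : Fin n → Fin m) {t u : Λ n} → t →β* u → rename f t →β* rename f u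
rename-→β* f = map* (rename f) (rename-→β f)

rename-→β⁺ : (f : Fin n → Fin m) {t u : Λ n} → t →β⁺ u → rename f t →β⁺ rename f u
rename-→β⁺ f = map⁺ (rename f) (rename-→β f)

-- A record rather than a predicate on functions, so that σ, ρ and ρ′ are inferred by unification.
record Relabels {n′ : ℕ} (σ : Fin m → Λ k) (ρ : Fin n′ → Fin m) (ρ′ : Fin n′ → Fin k) : Set where
  constructor relabels
  field relabel : ∀ x → σ (ρ x) ≡ var (ρ′ x)
open Relabels

relabels-weaken : ∀ {n′} {σ : Fin m → Λ k} {ρ : Fin n′ → Fin m} {ρ′} →
  Relabels σ ρ ρ′ → Relabels (exts σ) (suc ∘ ρ) (suc ∘ ρ′)
relabels-weaken e = relabels λ x → cong (rename suc) (relabel e x)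

relabels-ext : ∀ {n′} {σ : Fin m → Λ k} {ρ : Fin n′ → Fin m} {ρ′} →
  Relabels σ ρ ρ′ → Relabels (exts σ) (ext ρ) (ext ρ′)
relabels-ext e = relabels λ { zero → refl ; (suc x) → cong (rename suc) (relabel e x) }

module Translation (s : Λ 0) where

  -- The continuation λm. m (λx.(v : G, K)) ū of the translation of t(u, x.v), so that
  -- colon s (japp t u v) ρ G K is by definition colon s t ρ (app (embed s) G) (argCont ρ u v G K).
  argCont : (Fin n → Fin m) → J n → J (suc n) → Λ m → Λ m → Λ m
  argCont ρ u v G K =
    lam (app (app (var zero) (lam (colon s v (ext (wk ∘ ρ)) (rename wk2 G) (rename wk2 K))))
             (barR s u (wk ∘ ρ)))

  mutual
    subst-colon : ∀ {σ : Fin m → Λ k} {ρ : Fin n → Fin m} {ρ′} (t : J n) → Relabels σ ρ ρ′ →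
      ∀ G K → subst σ (colon s t ρ G K) ≡ colon s t ρ′ (subst σ G) (subst σ K)
    subst-colon {σ = σ} (jvar x) e G K = cong (λ M → app (app M (subst σ G)) (subst σ K)) (relabel e x)
    subst-colon {σ = σ} {ρ} (jlam t) e G K =
      cong (λ L → app (lam L) (subst σ G))
        (trans (subst-exts-weaken σ (app K (lam (lam (app (var (suc zero)) (barR s t (ext (wk ∘ ρ))))))))
               (cong (λ B → rename suc (app (subst σ K) (lam (lam (app (var (suc zero)) B)))))
                     (subst-barR t (relabels-ext (relabels-weaken e)))))
    subst-colon {σ = σ} {ρ} {ρ′} (japp t u v) e G K =
      trans (subst-colon t e _ _)
        (cong₂ (colon s t ρ′) (cong (λ S → app S (subst σ G)) (subst-embed σ s))
          (cong₂ (λ V U → lam (app (app (var zero) (lam V)) U))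
            (trans (subst-colon v (relabels-ext (relabels-weaken e)) _ _)
                   (cong₂ (colon s v (ext (wk ∘ ρ′))) (subst-exts²-weaken² σ G) (subst-exts²-weaken² σ K)))
            (subst-barR u (relabels-weaken e))))

    subst-barR : ∀ {σ : Fin m → Λ k} {ρ : Fin n → Fin m} {ρ′} (t : J n) → Relabels σ ρ ρ′ →
      subst σ (barR s t ρ) ≡ barR s t ρ′
    subst-barR t e = cong (lam ∘ lam) (subst-colon t (relabels-weaken (relabels-weaken e)) _ _)

  rename-colon : (t : J n) {ρ : Fin n → Fin m} (f : Fin m → Fin k) →
    ∀ G K → rename f (colon s t ρ G K) ≡ colon s t (f ∘ ρ) (rename f G) (rename f K)
  rename-colon t f G K =
    trans (sym (subst-var (λ _ → refl) _))
      (trans (subst-colon t (relabels λ _ → refl) G K)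
             (cong₂ (colon s t _) (subst-var (λ _ → refl) G) (subst-var (λ _ → refl) K)))

  rename-barR : (t : J n) {ρ : Fin n → Fin m} (f : Fin m → Fin k) →
    rename f (barR s t ρ) ≡ barR s t (f ∘ ρ)
  rename-barR t f = trans (sym (subst-var (λ _ → refl) _)) (subst-barR t (relabels λ _ → refl))

  ext-wk-∘ : ∀ {n′} {g : Fin n → Fin n′} {ρ : Fin n′ → Fin m} {ρ₂ : Fin n → Fin m} →
    (∀ x → ρ (g x) ≡ ρ₂ x) → ∀ x → ext (wk ∘ ρ) (ext g x) ≡ ext (wk ∘ ρ₂) x
  ext-wk-∘ e zero    = refl
  ext-wk-∘ e (suc x) = cong wk2 (e x)

  mutual
    colon-jrename : ∀ {n′} (t : J n) {g : Fin n → Fin n′} {ρ : Fin n′ → Fin m} {ρ₂ : Fin n → Fin m} →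
      (∀ x → ρ (g x) ≡ ρ₂ x) → ∀ G K → colon s (jrename g t) ρ G K ≡ colon s t ρ₂ G K
    colon-jrename (jvar x) e G K = cong (λ y → app (app (var y) G) K) (e x)
    colon-jrename (jlam t) e G K =
      cong (λ B → app (lam (rename suc (app K (lam (lam (app (var (suc zero)) B)))))) G)
           (barR-jrename t (ext-wk-∘ e))
    colon-jrename (japp t u v) {ρ₂ = ρ₂} e G K =
      trans (colon-jrename t e _ _)
        (cong₂ (λ V U → colon s t ρ₂ (app (embed s) G) (lam (app (app (var zero) (lam V)) U)))
               (colon-jrename v (ext-wk-∘ e) _ _) (barR-jrename u (cong suc ∘ e)))

    barR-jrename : ∀ {n′} (t : J n) {g : Fin n → Fin n′} {ρ : Fin n′ → Fin m} {ρ₂ : Fin n → Fin m} →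
      (∀ x → ρ (g x) ≡ ρ₂ x) → barR s (jrename g t) ρ ≡ barR s t ρ₂
    barR-jrename t e = cong (lam ∘ lam) (colon-jrename t (cong wk2 ∘ e) _ _)

  colonᴷ* : (t : J n) (ρ : Fin n → Fin m) (G : Λ m) {K K′ : Λ m} →
    K →β* K′ → colon s t ρ G K →β* colon s t ρ G K′
  colonᴷ* (jvar x)     ρ G p = appʳ* p
  colonᴷ* (jlam t)     ρ G p = appˡ* (lam* (rename-→β* suc (appˡ* p)))
  colonᴷ* (japp t u v) ρ G p =
    colonᴷ* t ρ _ (lam* (appˡ* (appʳ* (lam* (colonᴷ* v _ _ (rename-→β* wk2 p))))))

  colonᴷ⁺ : (t : J n) (ρ : Fin n → Fin m) (G : Λ m) {K K′ : Λ m} →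
    K →β⁺ K′ → colon s t ρ G K →β⁺ colon s t ρ G K′
  colonᴷ⁺ (jvar x)     ρ G p = appʳ⁺ p
  colonᴷ⁺ (jlam t)     ρ G p = appˡ⁺ (lam⁺ (rename-→β⁺ suc (appˡ⁺ p)))
  colonᴷ⁺ (japp t u v) ρ G p =
    colonᴷ⁺ t ρ _ (lam⁺ (appˡ⁺ (appʳ⁺ (lam⁺ (colonᴷ⁺ v _ _ (rename-→β⁺ wk2 p))))))

  colonᴳ⁺ : (t : J n) (ρ : Fin n → Fin m) {G G′ : Λ m} (K : Λ m) →
    G →β⁺ G′ → colon s t ρ G K →β⁺ colon s t ρ G′ K
  colonᴳ⁺ (jvar x)     ρ K p = appˡ⁺ (appʳ⁺ p)
  colonᴳ⁺ (jlam t)     ρ K p = appʳ⁺ p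
  colonᴳ⁺ (japp t u v) ρ K p =
    colonᴳ⁺ t ρ _ (appʳ⁺ p) ⁺◅◅*
    colonᴷ* t ρ _ (lam* (appˡ* (appʳ* (lam* (⁺⇒* (colonᴳ⁺ v _ _ (rename-→β⁺ wk2 p)))))))

  -- The substituted term either reduces to the translation T̄, or is a variable standing for a
  -- variable; the second case is needed under binders since y does not reduce to ȳ = λgk. y g k.
  data Represents {n′ : ℕ} (ρ : Fin n′ → Fin m) : Λ m → J n′ → Set where
    by-var       : ∀ y → Represents ρ (var (ρ y)) (jvar y)
    by-reduction : ∀ {M T} → M →β* barR s T ρ → Represents ρ M T

  represents-rename : ∀ {n′} {ρ : Fin n′ → Fin m} (f : Fin m → Fin k) {M T} →
    Represents ρ M T → Represents (f ∘ ρ) (rename f M) T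
  represents-rename f (by-var y) = by-var y
  represents-rename f {T = T} (by-reduction p) =
    by-reduction (rename-→β* f p ◅◅ Star.reflexive _→β_ (rename-barR T f))

  represents-jrename : ∀ {n′ n″} {ρ : Fin n″ → Fin m} (g : Fin n′ → Fin n″) {M T} →
    Represents (ρ ∘ g) M T → Represents ρ M (jrename g T)
  represents-jrename g (by-var y) = by-var (g y)
  represents-jrename g {T = T} (by-reduction p) =
    by-reduction (p ◅◅ Star.reflexive _→β_ (sym (barR-jrename T λ _ → refl)))

  record Simulates {n′ : ℕ} (σ : Fin m → Λ k) (ρ : Fin n → Fin m) (τ : Fin n → J n′)
                   (ρ′ : Fin n′ → Fin k) : Set where
    constructor simulates
    field simulate : ∀ x → Represents ρ′ (σ (ρ x)) (τ x)
  open Simulates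

  simulates-weaken : ∀ {n′} {σ : Fin m → Λ k} {ρ : Fin n → Fin m} {τ : Fin n → J n′} {ρ′} →
    Simulates σ ρ τ ρ′ → Simulates (exts σ) (suc ∘ ρ) τ (suc ∘ ρ′)
  simulates-weaken h = simulates λ x → represents-rename suc (simulate h x)

  simulates-ext : ∀ {n′} {σ : Fin m → Λ k} {ρ : Fin n → Fin m} {τ : Fin n → J n′} {ρ′} →
    Simulates σ ρ τ ρ′ → Simulates (exts (exts σ)) (ext (wk ∘ ρ)) (jexts τ) (ext (wk ∘ ρ′))
  simulates-ext h = simulates λ
    { zero    → by-var zero
    ; (suc x) → represents-jrename suc (simulate (simulates-weaken (simulates-weaken h)) x) }

  represents-app : ∀ {n′} {ρ : Fin n′ → Fin m} {M T} → Represents ρ M T →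
    ∀ G K → app (app M G) K →β* colon s T ρ G K
  represents-app (by-var y) G K = ε
  represents-app {ρ = ρ} {T = T} (by-reduction p) G K =
    appˡ* (appˡ* p) ◅◅ ξappˡ (β-≡ (cong lam (subst-colon T (relabels λ _ → refl) _ _)))
                    ◅ β-≡ (trans (subst-colon T (relabels λ _ → refl) _ _)
                                 (cong (λ G′ → colon s T ρ G′ K) (weaken-[] G K)))
                    ◅ ε

  mutual
    subst-colon-→β* : ∀ {n′} {σ : Fin m → Λ k} {ρ : Fin n → Fin m} {τ : Fin n → J n′} {ρ′}
      (t : J n) → Simulates σ ρ τ ρ′ → ∀ G K →
      subst σ (colon s t ρ G K) →β* colon s (jsubst τ t) ρ′ (subst σ G) (subst σ K)
    subst-colon-→β* (jvar x) h G K = represents-app (simulate h x) _ _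
    subst-colon-→β* {σ = σ} {ρ} (jlam t) h G K =
      Star.reflexive _→β_
        (cong (λ L → app (lam L) (subst σ G))
              (subst-exts-weaken σ (app K (lam (lam (app (var (suc zero)) (barR s t (ext (wk ∘ ρ)))))))))
      ◅◅ appˡ* (lam* (rename-→β* suc (appʳ* (lam* (lam* (appʳ* (subst-barR-→β* t (simulates-ext h))))))))
    subst-colon-→β* {σ = σ} {ρ} {τ} {ρ′} (japp t u v) h G K =
      subst-colon-→β* t h _ _
      ◅◅ Star.reflexive _→β_ (cong (λ S → colon s (jsubst τ t) ρ′ (app S (subst σ G)) (subst σ (argCont ρ u v G K)))
                                   (subst-embed σ s))
      ◅◅ colonᴷ* (jsubst τ t) ρ′ _
           (lam* (app* (appʳ* (lam* (subst-colon-→β* v (simulates-ext h) _ _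
                                      ◅◅ Star.reflexive _→β_
                                           (cong₂ (colon s (jsubst (jexts τ) v) _)
                                                  (subst-exts²-weaken² σ G) (subst-exts²-weaken² σ K)))))
                       (subst-barR-→β* u (simulates-weaken h))))

    subst-barR-→β* : ∀ {n′} {σ : Fin m → Λ k} {ρ : Fin n → Fin m} {τ : Fin n → J n′} {ρ′}
      (t : J n) → Simulates σ ρ τ ρ′ → subst σ (barR s t ρ) →β* barR s (jsubst τ t) ρ′
    subst-barR-→β* t h = lam* (lam* (subst-colon-→β* t (simulates-weaken (simulates-weaken h)) _ _))

  -- In these two lemmas the J-substitution τ is the one local to _⟦_⟧, found by unification.
  barR-[] : (t : J (suc n)) (u : J n) (ρ : Fin n → Fin m) →
    barR s t (ext ρ) [ barR s u ρ ] →β* barR s (t ⟦ u ⟧) ρ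
  barR-[] t u ρ = subst-barR-→β* t (simulates λ { zero → by-reduction ε ; (suc i) → by-var i })

  colon-[] : (v : J (suc n)) (u : J n) (ρ : Fin n → Fin m) (G K : Λ m) →
    colon s v (ext ρ) (rename suc G) (rename suc K) [ barR s u ρ ] →β* colon s (v ⟦ u ⟧) ρ G K
  colon-[] v u ρ G K =
    subst-colon-→β* v (simulates λ { zero → by-reduction ε ; (suc i) → by-var i }) _ _
    ◅◅ Star.reflexive _→β_ (cong₂ (colon s (v ⟦ u ⟧) ρ) (weaken-[] G _) (weaken-[] K _))

  rename-argCont : (ρ : Fin n → Fin m) (u : J n) (v : J (suc n)) (G K : Λ m) →
    rename wk2 (argCont ρ u v G K) ≡
    argCont (ext (wk ∘ ρ)) (jrename suc u) (jrename (ext suc) v) (rename wk2 G) (rename wk2 K)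
  rename-argCont ρ u v G K =
    cong₂ (λ V U → lam (app (app (var zero) (lam V)) U))
      (trans (rename-colon v (ext (ext wk2)) _ _)
        (trans (cong₂ (colon s v _) (wk2-comm G) (wk2-comm K))
               (sym (colon-jrename v (λ { zero → refl ; (suc x) → refl }) _ _))))
      (trans (rename-barR u (ext wk2)) (sym (barR-jrename u λ _ → refl)))
    where
    wk2-comm : ∀ X → rename (ext (ext wk2)) (rename wk2 X) ≡ rename wk2 (rename wk2 X)
    wk2-comm X = trans (rename-rename (λ _ → refl) X) (sym (rename-rename (λ _ → refl) X))

  argCont-app : (ρ : Fin n → Fin m) (u : J n) (v : J (suc n)) (G K M : Λ m) →
    app (argCont ρ u v G K) M →β
    app (app M (lam (colon s v (ext ρ) (rename suc G) (rename suc K)))) (barR s u ρ)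
  argCont-app ρ u v G K M =
    β-≡ (cong₂ (λ C U → app (app M (lam C)) U)
               (trans (subst-colon v (relabels λ { zero → refl ; (suc x) → refl }) _ _)
                      (cong₂ (colon s v (ext ρ)) (subst-exts-wk2 (λ _ → refl) G)
                                                 (subst-exts-wk2 (λ _ → refl) K)))
               (subst-barR u (relabels λ _ → refl)))

  -- (λy. K₁ W) G⁺ → K₁ W → W (λx.C₀) ū → (λx. (λx.C₀) t̄) ū → (λx.C₀) [ū/x]t̄
  --   ↠ (λx.C₀) ‾([u/x]t) → [‾([u/x]t)/x]C₀ ↠ ([[u/x]t/x]v : G, K),
  -- where K₁ = argCont ρ u v G K, W = λwx. w t̄ and C₀ = (v : G, K).
  colon-βJ : (t : J (suc n)) (u : J n) (v : J (suc n)) (ρ : Fin n → Fin m) (G K : Λ m) →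
    colon s (japp (jlam t) u v) ρ G K →β⁺ colon s (v ⟦ t ⟦ u ⟧ ⟧) ρ G K
  colon-βJ t u v ρ G K =
    β-≡ (weaken-[] (app (argCont ρ u v G K) W) (app (embed s) G))
    ◅⁺ argCont-app ρ u v G K W
    ◅ ξappˡ (β-≡ (cong (λ B → lam (app (rename suc (lam C₀)) B))
                       (subst-barR t (relabels λ { zero → refl ; (suc x) → refl }))))
    ◅ β-≡ (cong (λ L → app L (barR s t (ext ρ) [ barR s u ρ ])) (weaken-[] (lam C₀) _))
    ◅ appʳ* (barR-[] t u ρ)
    ◅◅ β
    ◅ colon-[] v (t ⟦ u ⟧) ρ G K
    where
    W  = lam (lam (app (var (suc zero)) (barR s t (ext (wk ∘ ρ)))))
    C₀ = colon s v (ext ρ) (rename suc G) (rename suc K)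

module Simulation (s : Λ 0) (s-→β⁺ : ∀ {n} (G : Λ n) → app (embed s) G →β⁺ G) where
  open Translation s

  mutual
    colon-πJ : (t u : J n) (v : J (suc n)) (u′ : J n) (v′ : J (suc n)) (ρ : Fin n → Fin m) (G K : Λ m) →
      colon s (japp (japp t u v) u′ v′) ρ G K →β⁺
      colon s (japp t u (appBody v (jrename suc u′) (jrename (ext suc) v′))) ρ G K
    colon-πJ t u v u′ v′ ρ G K =
      colonᴳ⁺ t ρ _ (s-→β⁺ (app (embed s) G))
      ⁺◅◅* colonᴷ* t ρ _ (lam* (appˡ* (appʳ* (lam* (colon-appBody-weaken v ρ u′ v′ G K)))))

    colon-appBody : (v : J n) (ρ : Fin n → Fin m) (u′ : J n) (v′ : J (suc n)) (G K : Λ m) →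
      colon s v ρ (app (embed s) G) (argCont ρ u′ v′ G K) →β* colon s (appBody v u′ v′) ρ G K
    colon-appBody (jvar x)     ρ u′ v′ G K = ε
    colon-appBody (jlam t)     ρ u′ v′ G K = ε
    colon-appBody (japp t u v) ρ u′ v′ G K = ⁺⇒* (colon-πJ t u v u′ v′ ρ G K)

    colon-appBody-weaken : (v : J (suc n)) (ρ : Fin n → Fin m) (u′ : J n) (v′ : J (suc n)) (G K : Λ m) →
      colon s v (ext (wk ∘ ρ)) (rename wk2 (app (embed s) G)) (rename wk2 (argCont ρ u′ v′ G K)) →β*
      colon s (appBody v (jrename suc u′) (jrename (ext suc) v′)) (ext (wk ∘ ρ)) (rename wk2 G) (rename wk2 K)
    colon-appBody-weaken v ρ u′ v′ G K =
      Star.reflexive _→β_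
        (cong₂ (colon s v (ext (wk ∘ ρ)))
               (cong (λ S → app S (rename wk2 G)) (rename-embed wk2 s))
               (rename-argCont ρ u′ v′ G K))
      ◅◅ colon-appBody v (ext (wk ∘ ρ)) (jrename suc u′) (jrename (ext suc) v′) (rename wk2 G) (rename wk2 K)

  mutual
    colon-→J : ∀ {t u : J n} → t →J u → (ρ : Fin n → Fin m) (G K : Λ m) →
      colon s t ρ G K →β⁺ colon s u ρ G K
    colon-→J (βJ {t} {u} {v})           ρ G K = colon-βJ t u v ρ G K
    colon-→J (πJ {t} {u} {v} {u′} {v′}) ρ G K = colon-πJ t u v u′ v′ ρ G K
    colon-→J (ξlam r)     ρ G K =
      appˡ⁺ (lam⁺ (rename-→β⁺ suc (appʳ⁺ (lam⁺ (lam⁺ (appʳ⁺ (barR-→J r (ext (wk ∘ ρ)))))))))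
    colon-→J (ξ₁ r)       ρ G K = colon-→J r ρ _ _
    colon-→J (ξ₂ {t} r)   ρ G K = colonᴷ⁺ t ρ _ (lam⁺ (appʳ⁺ (barR-→J r (wk ∘ ρ))))
    colon-→J (ξ₃ {t} r)   ρ G K =
      colonᴷ⁺ t ρ _ (lam⁺ (appˡ⁺ (appʳ⁺ (lam⁺ (colon-→J r (ext (wk ∘ ρ)) _ _)))))

    barR-→J : ∀ {t u : J n} → t →J u → (ρ : Fin n → Fin m) → barR s t ρ →β⁺ barR s u ρ
    barR-→J r ρ = lam⁺ (lam⁺ (colon-→J r (wk2 ∘ ρ) _ _))

theorem4p9 : (s : Λ 0) →
    (∀ {n} (G : Λ n) → app (embed s) G →β⁺ G) →
    ∀ {n} {t u : J n} → t →J u → translate s t →β⁺ translate s u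
theorem4p9 s s-→β⁺ r = Simulation.barR-→J s s-→β⁺ r id
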